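{- For every string $x\in\{0,1\}^*$, the graph $G_x$ defined below together with its planar grid embedding is computable in $\mathrm{AC}^0$ from $x$; that is, there is a family of constant-depth, polynomial-size, unbounded fan-in circuits of AND, OR, NOT gates which on input $x\in\{0,1\}^n$ outputs, for each relevant lattice point, whether it is a vertex of $G_x$, and for each relevant pair of lattice points, whether they are joined by an edge of $G_x$.
   Context: Construction of $G_x$. For $x=x_1\cdots x_n$ let $f(x)=0\,\mathrm{bd}(0x_10x_20\cdots0x_n0)\,0$, where $\mathrm{bd}(y_1\cdots y_k)=y_1y_1\cdots y_ky_k$. Write $f(x)=y_1\cdots y_m$ ($m$ even) and split it into constituent pairs $P_k=y_{2k-1}y_{2k}$, $k=1,\dots,m/2$; each $P_k\in\{00,01,10\}$. Three blocks are defined, each drawn in a $2\times 6$ piece of the integer lattice with local columns $0,1$ and rows $0,\dots,5$: - $G_{00}$: vertices $(0,0),(1,0),(0,5),(1,5),(0,2),(0,3)$; edges $(0,0)(1,0)$, $(0,5)(1,5)$, $(0,2)(0,3)$. - $G_{01}$: vertices $(0,1),(1,1),(0,4),(1,4),(1,2),(1,3)$; edges $(0,1)(1,1)$, $(0,4)(1,4)$, $(1,2)(1,3)$. - $G_{10}$: vertices $(0,0),(1,0),(0,5),(1,5),(0,1),(0,4)$; edges $(0,0)(1,0)$, $(0,0)(0,1)$, $(0,5)(1,5)$, $(0,5)(0,4)$. $G_x=G_{P_1}\odot\cdots\odot G_{P_{m/2}}$ is obtained by placing a copy of block $G_{P_k}$ in global columns $2k-2,2k-1$, and for each $k<m/2$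 adding the two edges $(2k-1,a_k)(2k,b_{k+1})$ and $(2k-1,5-a_k)(2k,5-b_{k+1})$, where $a_k=1$ if $P_k=01$ and $0$ otherwise, and $b_{k+1}=1$ if $P_{k+1}\in\{01,10\}$ and $0$ if $P_{k+1}=00$. -}

module Defs where

open import Data.Nat using (ℕ; zero; suc; _+_; _*_; _∸_; _⊔_)
open import Data.Bool using (Bool; true; false; _∧_; _∨_; not)
open import Data.Fin using (Fin; toℕ)
open import Data.Vec using (Vec; lookup; toList)
open import Data.List using (List; []; _∷_; _++_; map; allFin; cartesianProduct)
import Data.List
open import Data.Nat.ListAction using (sum)
open import Data.Product using (_×_; _,_)

-- lattice points (column , row)
Pt : Set
Pt = ℕ × ℕ

Edge : Set
Edge = Pt × Pt

interleave : List Bool → List Bool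
interleave []       = false ∷ []
interleave (b ∷ bs) = false ∷ b ∷ interleave bs

bd : List Bool → List Bool
bd []       = []
bd (y ∷ ys) = y ∷ y ∷ bd ys

f : List Bool → List Bool
f x = false ∷ (bd (interleave x) ++ (false ∷ []))

pairs : List Bool → List (Bool × Bool)
pairs (a ∷ b ∷ ys) = (a , b) ∷ pairs ys
pairs _            = []

-- block vertices in local coordinates (local column, row)
blockV : Bool × Bool → List Pt
blockV (false , false) = (0 , 0) ∷ (1 , 0) ∷ (0 , 5) ∷ (1 , 5) ∷ (0 , 2) ∷ (0 , 3) ∷ []
blockV (false , true)  = (0 , 1) ∷ (1 , 1) ∷ (0 , 4) ∷ (1 , 4) ∷ (1 , 2) ∷ (1 , 3) ∷ []
blockV (true  , false) = (0 , 0) ∷ (1 , 0) ∷ (0 , 5) ∷ (1 , 5) ∷ (0 , 1) ∷ (0 , 4) ∷ []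
blockV (true  , true)  = []   -- the pair 11 never occurs in f(x)

blockE : Bool × Bool → List Edge
blockE (false , false) = ((0 , 0) , (1 , 0)) ∷ ((0 , 5) , (1 , 5)) ∷ ((0 , 2) , (0 , 3)) ∷ []
blockE (false , true)  = ((0 , 1) , (1 , 1)) ∷ ((0 , 4) , (1 , 4)) ∷ ((1 , 2) , (1 , 3)) ∷ []
blockE (true  , false) = ((0 , 0) , (1 , 0)) ∷ ((0 , 0) , (0 , 1)) ∷ ((0 , 5) , (1 , 5)) ∷ ((0 , 5) , (0 , 4)) ∷ []
blockE (true  , true)  = []

aOf : Bool × Bool → ℕ
aOf (false , true) = 1
aOf _              = 0

bOf : Bool × Bool → ℕ
bOf (false , false) = 0
bOf _               = 1

shiftP : ℕ → Pt → Pt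
shiftP o (c , r) = (o + c , r)

shiftE : ℕ → Edge → Edge
shiftE o (p , q) = (shiftP o p , shiftP o q)

-- o = column offset 2k-2 of the current block
vertsFrom : ℕ → List (Bool × Bool) → List Pt
vertsFrom o []       = []
vertsFrom o (p ∷ ps) = map (shiftP o) (blockV p) ++ vertsFrom (2 + o) ps

connE : ℕ → Bool × Bool → Bool × Bool → List Edge
connE o p q =
  ((o + 1 , aOf p) , (o + 2 , bOf q)) ∷
  ((o + 1 , 5 ∸ aOf p) , (o + 2 , 5 ∸ bOf q)) ∷ []

edgesFrom : ℕ → List (Bool × Bool) → List Edge
edgesFrom o []           = []
edgesFrom o (p ∷ [])     = map (shiftE o) (blockE p)
edgesFrom o (p ∷ q ∷ ps) = map (shiftE o) (blockE p) ++ connE o p q ++ edgesFrom (2 + o) (q ∷ ps)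

-- vertex and edge lists of G_x (edges are unordered; listed once)
Gx-V : List Bool → List Pt
Gx-V x = vertsFrom 0 (pairs (f x))

Gx-E : List Bool → List Edge
Gx-E x = edgesFrom 0 (pairs (f x))

-- |f(x)| = 4n+4, so G_x lives in columns 0..4n+3, rows 0..5
cols : ℕ → ℕ
cols n = 4 * n + 4

-- Boolean circuits (unbounded fan-in AND/OR, NOT), as formulas

data Circ (n : ℕ) : Set where
  var  : Fin n → Circ n
  notG : Circ n → Circ n
  andG : List (Circ n) → Circ n
  orG  : List (Circ n) → Circ n

mutual
  eval : ∀ {n} → Circ n → Vec Bool n → Bool
  eval (var i)   x = lookup x i
  eval (notG c)  x = not (eval c x)
  eval (andG cs) x = evalAnd cs x
  eval (orG cs)  x = evalOr cs x

  evalAnd : ∀ {n} → List (Circ n) → Vec Bool n → Bool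
  evalAnd []       x = true
  evalAnd (c ∷ cs) x = eval c x ∧ evalAnd cs x

  evalOr : ∀ {n} → List (Circ n) → Vec Bool n → Bool
  evalOr []       x = false
  evalOr (c ∷ cs) x = eval c x ∨ evalOr cs x

mutual
  depth : ∀ {n} → Circ n → ℕ
  depth (var i)   = 0
  depth (notG c)  = suc (depth c)
  depth (andG cs) = suc (depthL cs)
  depth (orG cs)  = suc (depthL cs)

  depthL : ∀ {n} → List (Circ n) → ℕ
  depthL []       = 0
  depthL (c ∷ cs) = depth c ⊔ depthL cs

mutual
  size : ∀ {n} → Circ n → ℕ
  size (var i)   = 1
  size (notG c)  = suc (size c)
  size (andG cs) = suc (sizeL cs)
  size (orG cs)  = suc (sizeL cs)

  sizeL : ∀ {n} → List (Circ n) → ℕ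
  sizeL []       = 0
  sizeL (c ∷ cs) = size c + sizeL cs

data GridPt (n : ℕ) : Set where
  gp : Fin (cols n) → Fin 6 → GridPt n

toPt : ∀ {n} → GridPt n → Pt
toPt (gp c r) = (toℕ c , toℕ r)

gridPts : (n : ℕ) → List (GridPt n)
gridPts n = Data.List.cartesianProductWith gp (allFin (cols n)) (allFin 6)

gridPairs : (n : ℕ) → List (GridPt n × GridPt n)
gridPairs n = cartesianProduct (gridPts n) (gridPts n)

totalSize : (n : ℕ) → (GridPt n → Circ n) → (GridPt n → GridPt n → Circ n) → ℕ
totalSize n V E =
  sum (map (λ p → size (V p)) (gridPts n)) +
  sum (map (λ pq → size (E (Data.Product.proj₁ pq) (Data.Product.proj₂ pq))) (gridPairs n))

module Submission where

-- The constituent pairs of f(x) are 00, then 0xᵢ and xᵢ0 for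
-- i = 1..n, then 00 (pairs-f), so every pair depends on at most one input
-- bit (a OneBit value).  A circuit can branch on such a value with a
-- multiplexer of depth 2 and six gates (select), hence any Boolean test of one
-- or two pairs is a circuit of constant depth and size.  G_x is a
-- concatenation of blocks, block k occupying columns 2k-2 and 2k-1 (verts-cons,
-- edges-cons): (c, r) is a vertex iff it is a vertex of block ⌊c/2⌋, and an
-- edge starting in column c is decided by the pairs of blocks ⌊c/2⌋ and
-- ⌊c/2⌋+1.  The circuits vertexCirc and edgeCirc walk to that block while
-- being built and test the relevant pairs; their correctness rests on two
-- general facts about membership in A ++ map g L.  Every output circuit has
-- depth ≤ 6 and size ≤ 45, and there are O((n+1)²) outputs, which gives
-- lemma6 at the end of the file.

open import Defs
open import Data.Nat using (ℕ; zero; suc; _+_; _∸_; _*_; _^_; _≤_; z≤n; s≤s)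
open import Data.Nat.Properties
  using (_≟_; ⊔-lub; +-mono-≤; +-monoˡ-≤; +-monoʳ-≤; *-monoʳ-≤; *-suc; *-distribˡ-+;
         m≤n+m; m≤m+n; m≤m*n; *-assoc; ≤-trans; module ≤-Reasoning)
open import Data.Nat.ListAction using (sum)
open import Data.Nat.Tactic.RingSolver using (solve-∀)
open import Data.Bool using (Bool; true; false; T; _∨_)
open import Data.Bool.Properties using (∧-identityʳ; ∨-identityʳ; T-∨)
open import Data.Fin using (Fin; toℕ)
import Data.Fin as Fin
open import Data.Vec using (Vec; lookup; toList; []; _∷_)
open import Data.List using (List; []; _∷_; _++_; map; length; head; allFin; cartesianProductWith)
open import Data.List.Properties
  using (map-++; map-∘; map-id; map-cong; ++-assoc; ++-identityʳ; length-++; length-map; length-tabulate)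
open import Data.List.Membership.Propositional using (_∈_; _∉_)
open import Data.List.Membership.Propositional.Properties using (∈-map⁺; ∈-map⁻; ∈-++⁺ˡ; ∈-++⁺ʳ; ∈-++⁻)
open import Data.List.Relation.Unary.All using (All; []; _∷_)
import Data.List.Relation.Unary.All as All
open import Data.List.Relation.Unary.All.Properties using (++⁺)
open import Data.Maybe using (Maybe; nothing; just)
open import Data.Product using (Σ; _×_; _,_; proj₁; proj₂)
open import Data.Product.Properties using (≡-dec)
open import Data.Sum using (_⊎_; inj₁; inj₂)
open import Data.Sum.Function.Propositional using (_⊎-⇔_)
open import Data.Empty using (⊥-elim)
open import Relation.Nullary using (Dec; ¬_)
open import Relation.Nullary.Decidable using (isYes; toWitness; fromWitness)
open import Relation.Binary.PropositionalEquality
open import Function using (_∘_)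
open import Function.Bundles using (_⇔_; mk⇔; Equivalence)
open import Function.Definitions using (Injective)
open import Function.Properties.Equivalence using () renaming (sym to ⇔-sym; trans to ⇔-trans)
open import Function.Related.Propositional using (equivalence)
import Function.Related.Propositional as Related

module ⇔-Reasoning = Related.EquationalReasoning {k = equivalence}

private
  variable
    n : ℕ
    A B : Set

decided : ∀ {P : Set} (d : Dec P) → T (isYes d) ⇔ P
decided d = mk⇔ toWitness fromWitness

_≟Pt_ : (u v : Pt) → Dec (u ≡ v)
_≟Pt_ = ≡-dec _≟_ _≟_

_≟Edge_ : (e e′ : Edge) → Dec (e ≡ e′)
_≟Edge_ = ≡-dec _≟Pt_ _≟Pt_

open import Data.List.Membership.DecPropositional _≟Pt_ using () renaming (_∈?_ to _∈Pt?_)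
open import Data.List.Membership.DecPropositional _≟Edge_ using () renaming (_∈?_ to _∈Edge?_)

pairsOfBits : List Bool → List (Bool × Bool)
pairsOfBits []       = (false , false) ∷ []
pairsOfBits (b ∷ bs) = (false , b) ∷ (b , false) ∷ pairsOfBits bs

-- Reading a ∷ bd(0x₁0x₂⋯0xₙ0) ∷ 0 two letters at a time; the leading letter a
-- pairs with the first 0 of the doubled word.
pairs-tail : ∀ a xs → pairs (a ∷ bd (interleave xs) ++ false ∷ []) ≡ (a , false) ∷ pairsOfBits xs
pairs-tail a []       = refl
pairs-tail a (b ∷ bs) = cong (λ ps → (a , false) ∷ (false , b) ∷ ps) (pairs-tail b bs)

pairs-f : ∀ xs → pairs (f xs) ≡ (false , false) ∷ pairsOfBits xs
pairs-f = pairs-tail false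

-- Values that depend on at most one input bit

-- A value of type A determined by the input x ∈ {0,1}ⁿ through at most one bit.
data OneBit (n : ℕ) (A : Set) : Set where
  const : A → OneBit n A
  onBit : Fin n → (Bool → A) → OneBit n A

value : Vec Bool n → OneBit n A → A
value x (const a)   = a
value x (onBit i g) = g (lookup x i)

mapOneBit : (A → B) → OneBit n A → OneBit n B
mapOneBit g (const a)   = const (g a)
mapOneBit g (onBit i h) = onBit i (g ∘ h)

value-map : ∀ (g : A → B) (x : Vec Bool n) s → value x (mapOneBit g s) ≡ g (value x s)
value-map g x (const a)   = refl
value-map g x (onBit i h) = refl

weaken : OneBit n A → OneBit (suc n) A
weaken (const a)   = const a
weaken (onBit i g) = onBit (Fin.suc i) g

value-weaken : ∀ b (x : Vec Bool n) (s : OneBit n A) → value (b ∷ x) (weaken s) ≡ value x s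
value-weaken b x (const a)   = refl
value-weaken b x (onBit i g) = refl

nextOf : List (OneBit n A) → OneBit n (Maybe A)
nextOf []      = const nothing
nextOf (s ∷ _) = mapOneBit just s

value-nextOf : ∀ (x : Vec Bool n) (ss : List (OneBit n A)) → value x (nextOf ss) ≡ head (map (value x) ss)
value-nextOf x []      = refl
value-nextOf x (s ∷ _) = value-map just x s

symPairsOfBits : (n : ℕ) → List (OneBit n (Bool × Bool))
symPairsOfBits zero    = const (false , false) ∷ []
symPairsOfBits (suc n) =
  onBit Fin.zero (false ,_) ∷ onBit Fin.zero (_, false) ∷ map weaken (symPairsOfBits n)

symPairs : (n : ℕ) → List (OneBit n (Bool × Bool))
symPairs n = const (false , false) ∷ symPairsOfBits n

values-symPairsOfBits : ∀ n (x : Vec Bool n) → map (value x) (symPairsOfBits n) ≡ pairsOfBits (toList x)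
values-symPairsOfBits zero    []      = refl
values-symPairsOfBits (suc n) (b ∷ x) = cong (λ ps → (false , b) ∷ (b , false) ∷ ps) (begin
  map (value (b ∷ x)) (map weaken (symPairsOfBits n)) ≡⟨ map-∘ (symPairsOfBits n) ⟨
  map (value (b ∷ x) ∘ weaken) (symPairsOfBits n)     ≡⟨ map-cong (value-weaken b x) (symPairsOfBits n) ⟩
  map (value x) (symPairsOfBits n)                    ≡⟨ values-symPairsOfBits n x ⟩
  pairsOfBits (toList x)                              ∎)
  where open ≡-Reasoning

values-symPairs : ∀ n (x : Vec Bool n) → map (value x) (symPairs n) ≡ pairs (f (toList x))
values-symPairs n x = trans (cong ((false , false) ∷_) (values-symPairsOfBits n x)) (sym (pairs-f (toList x)))

K : Bool → Circ n
K true  = andG []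
K false = orG []

eval-K : ∀ b (x : Vec Bool n) → eval (K b) x ≡ b
eval-K true  x = refl
eval-K false x = refl

mux : Fin n → (Bool → Circ n) → Circ n
mux i C = orG (andG (var i ∷ C true ∷ []) ∷ andG (notG (var i) ∷ C false ∷ []) ∷ [])

eval-mux : ∀ i C (x : Vec Bool n) → eval (mux i C) x ≡ eval (C (lookup x i)) x
eval-mux i C x with lookup x i
... | true  = trans (∨-identityʳ _) (∧-identityʳ _)
... | false = trans (∨-identityʳ _) (∧-identityʳ _)

select : OneBit n A → (A → Circ n) → Circ n
select (const a)   k = k a
select (onBit i g) k = mux i (k ∘ g)

eval-select : ∀ (s : OneBit n A) k x → eval (select s k) x ≡ eval (k (value x s)) x
eval-select (const a)   k x = refl
eval-select (onBit i g) k x = eval-mux i (k ∘ g) x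

eval-selectK : ∀ (s : OneBit n A) (t : A → Bool) x → eval (select s (K ∘ t)) x ≡ t (value x s)
eval-selectK s t x = trans (eval-select s (K ∘ t) x) (eval-K (t (value x s)) x)

eval-selectK₂ : ∀ (s : OneBit n A) (s′ : OneBit n B) (t : A → B → Bool) x →
  eval (select s (λ a → select s′ (K ∘ t a))) x ≡ t (value x s) (value x s′)
eval-selectK₂ s s′ t x =
  trans (eval-select s (λ a → select s′ (K ∘ t a)) x) (eval-selectK s′ (t (value x s)) x)

record Small (d S : ℕ) (C : Circ n) : Set where
  constructor small
  field
    depth-≤ : depth C ≤ d
    size-≤  : size C ≤ S
open Small

small-weaken : ∀ {d d′ S S′} {C : Circ n} → d ≤ d′ → S ≤ S′ → Small d S C → Small d′ S′ C
small-weaken d≤d′ S≤S′ (small dC sC) = small (≤-trans dC d≤d′) (≤-trans sC S≤S′)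

K-small : ∀ b → Small 1 1 (K {n} b)
K-small true  = small (s≤s z≤n) (s≤s z≤n)
K-small false = small (s≤s z≤n) (s≤s z≤n)

size-mux : ∀ i (C : Bool → Circ n) → size (mux i C) ≡ 6 + (size (C true) + size (C false))
size-mux i C = identity (size (C true)) (size (C false))
  where
  identity : ∀ a b → suc (suc (suc (a + 0)) + (suc (suc (suc (b + 0))) + 0)) ≡ 6 + (a + b)
  identity = solve-∀

mux-small : ∀ {d S} i (C : Bool → Circ n) → (∀ b → Small (suc d) S (C b)) → Small (3 + d) (6 + (S + S)) (mux i C)
mux-small {d = d} {S} i C branch-small = small mux-depth mux-size
  where
  mux-depth : depth (mux i C) ≤ 3 + d
  mux-depth = s≤s (⊔-lub (s≤s (⊔-lub z≤n (⊔-lub (depth-≤ (branch-small true)) z≤n)))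
                         (⊔-lub (s≤s (⊔-lub (s≤s z≤n) (⊔-lub (depth-≤ (branch-small false)) z≤n))) z≤n))
  mux-size : size (mux i C) ≤ 6 + (S + S)
  mux-size = begin
    size (mux i C)                        ≡⟨ size-mux i C ⟩
    6 + (size (C true) + size (C false))  ≤⟨ +-monoʳ-≤ 6 (+-mono-≤ (size-≤ (branch-small true)) (size-≤ (branch-small false))) ⟩
    6 + (S + S)                           ∎
    where open ≤-Reasoning

select-small : ∀ {d S} (s : OneBit n A) k → (∀ a → Small (suc d) S (k a)) → Small (3 + d) (6 + (S + S)) (select s k)
select-small {d = d} {S} (const a) k k-small = small-weaken (m≤n+m (suc d) 2) (m≤n+m S (6 + S)) (k-small a)
select-small (onBit i g) k k-small = mux-small i (k ∘ g) (k-small ∘ g)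

module _ {X Y : Set} {g : Y → X} where

  ∈-++-map-outside : ∀ A L {x} → (∀ y → g y ≢ x) → (x ∈ A ++ map g L) ⇔ (x ∈ A)
  ∈-++-map-outside A L {x} outside = mk⇔ fromLeft ∈-++⁺ˡ
    where
    fromLeft : x ∈ A ++ map g L → x ∈ A
    fromLeft m with ∈-++⁻ A m
    ... | inj₁ x∈A  = x∈A
    ... | inj₂ x∈gL with ∈-map⁻ g x∈gL
    ...   | y , _ , x≡gy = ⊥-elim (outside y (sym x≡gy))

  ∈-++-map-image : Injective _≡_ _≡_ g → ∀ A L {y} → g y ∉ A → (g y ∈ A ++ map g L) ⇔ (y ∈ L)
  ∈-++-map-image injective A L {y} gy∉A = mk⇔ fromRight (∈-++⁺ʳ A ∘ ∈-map⁺ g)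
    where
    fromRight : g y ∈ A ++ map g L → y ∈ L
    fromRight m with ∈-++⁻ A m
    ... | inj₁ gy∈A  = ⊥-elim (gy∉A gy∈A)
    ... | inj₂ gy∈gL with ∈-map⁻ g gy∈gL
    ...   | y′ , y′∈L , gy≡gy′ = subst (_∈ L) (sym (injective gy≡gy′)) y′∈L

-- G_x as a concatenation of blocks

InFirstBlock : Pt → Set
InFirstBlock v = proj₁ v ≤ 1

shifted-not-first : ∀ v → ¬ InFirstBlock (shiftP 2 v)
shifted-not-first v (s≤s ())

first-not-shifted : ∀ {v} → InFirstBlock v → ∀ u → shiftP 2 u ≢ v
first-not-shifted v-first u refl = shifted-not-first u v-first

shiftP-injective : Injective _≡_ _≡_ (shiftP 2)
shiftP-injective = cong unshift
  where
  unshift : Pt → Pt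
  unshift (c , r) = (c ∸ 2 , r)

shiftE-injective : Injective _≡_ _≡_ (shiftE 2)
shiftE-injective eq = cong₂ _,_ (shiftP-injective (cong proj₁ eq)) (shiftP-injective (cong proj₂ eq))

blockV-first : ∀ p → All InFirstBlock (blockV p)
blockV-first (false , false) = z≤n ∷ s≤s z≤n ∷ z≤n ∷ s≤s z≤n ∷ z≤n ∷ z≤n ∷ []
blockV-first (false , true)  = z≤n ∷ s≤s z≤n ∷ z≤n ∷ s≤s z≤n ∷ s≤s z≤n ∷ s≤s z≤n ∷ []
blockV-first (true  , false) = z≤n ∷ s≤s z≤n ∷ z≤n ∷ s≤s z≤n ∷ z≤n ∷ z≤n ∷ []
blockV-first (true  , true)  = []

localEdges : Bool × Bool → Maybe (Bool × Bool) → List Edge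
localEdges p nothing  = blockE p
localEdges p (just q) = blockE p ++ connE 0 p q

blockE-first : ∀ p → All (InFirstBlock ∘ proj₁) (blockE p)
blockE-first (false , false) = z≤n ∷ z≤n ∷ z≤n ∷ []
blockE-first (false , true)  = z≤n ∷ z≤n ∷ s≤s z≤n ∷ []
blockE-first (true  , false) = z≤n ∷ z≤n ∷ z≤n ∷ z≤n ∷ []
blockE-first (true  , true)  = []

localEdges-first : ∀ p mq → All (InFirstBlock ∘ proj₁) (localEdges p mq)
localEdges-first p nothing  = blockE-first p
localEdges-first p (just q) = ++⁺ (blockE-first p) (s≤s z≤n ∷ s≤s z≤n ∷ [])

verts-shift : ∀ o ps → vertsFrom (2 + o) ps ≡ map (shiftP 2) (vertsFrom o ps)
verts-shift o []       = refl
verts-shift o (p ∷ ps) = begin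
  map (shiftP (2 + o)) (blockV p) ++ vertsFrom (2 + (2 + o)) ps
    ≡⟨ cong₂ _++_ (map-∘ (blockV p)) (verts-shift (2 + o) ps) ⟩
  map (shiftP 2) (map (shiftP o) (blockV p)) ++ map (shiftP 2) (vertsFrom (2 + o) ps)
    ≡⟨ map-++ (shiftP 2) (map (shiftP o) (blockV p)) _ ⟨
  map (shiftP 2) (vertsFrom o (p ∷ ps)) ∎
  where open ≡-Reasoning

verts-cons : ∀ p ps → vertsFrom 0 (p ∷ ps) ≡ blockV p ++ map (shiftP 2) (vertsFrom 0 ps)
verts-cons p ps = cong₂ _++_ (map-id (blockV p)) (verts-shift 0 ps)

edges-shift : ∀ o ps → edgesFrom (2 + o) ps ≡ map (shiftE 2) (edgesFrom o ps)
edges-shift o []           = refl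
edges-shift o (p ∷ [])     = map-∘ (blockE p)
edges-shift o (p ∷ q ∷ ps) = begin
  map (shiftE (2 + o)) (blockE p) ++ connE (2 + o) p q ++ edgesFrom (2 + (2 + o)) (q ∷ ps)
    ≡⟨ cong₂ _++_ (map-∘ (blockE p)) (cong (connE (2 + o) p q ++_) (edges-shift (2 + o) (q ∷ ps))) ⟩
  map (shiftE 2) (map (shiftE o) (blockE p)) ++ map (shiftE 2) (connE o p q) ++ map (shiftE 2) (edgesFrom (2 + o) (q ∷ ps))
    ≡⟨ cong (map (shiftE 2) (map (shiftE o) (blockE p)) ++_) (map-++ (shiftE 2) (connE o p q) _) ⟨
  map (shiftE 2) (map (shiftE o) (blockE p)) ++ map (shiftE 2) (connE o p q ++ edgesFrom (2 + o) (q ∷ ps))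
    ≡⟨ map-++ (shiftE 2) (map (shiftE o) (blockE p)) _ ⟨
  map (shiftE 2) (edgesFrom o (p ∷ q ∷ ps)) ∎
  where open ≡-Reasoning

edges-cons : ∀ p ps → edgesFrom 0 (p ∷ ps) ≡ localEdges p (head ps) ++ map (shiftE 2) (edgesFrom 0 ps)
edges-cons p []       = trans (map-id (blockE p)) (sym (++-identityʳ (blockE p)))
edges-cons p (q ∷ ps) = trans (cong₂ _++_ (map-id (blockE p)) (cong (connE 0 p q ++_) (edges-shift 0 (q ∷ ps))))
                              (sym (++-assoc (blockE p) (connE 0 p q) _))

vertex-first : ∀ p ps {v} → InFirstBlock v → (v ∈ vertsFrom 0 (p ∷ ps)) ⇔ (v ∈ blockV p)
vertex-first p ps v-first rewrite verts-cons p ps =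
  ∈-++-map-outside (blockV p) (vertsFrom 0 ps) (first-not-shifted v-first)

vertex-shifted : ∀ p ps v → (shiftP 2 v ∈ vertsFrom 0 (p ∷ ps)) ⇔ (v ∈ vertsFrom 0 ps)
vertex-shifted p ps v rewrite verts-cons p ps =
  ∈-++-map-image shiftP-injective (blockV p) (vertsFrom 0 ps)
    (λ m → shifted-not-first v (All.lookup (blockV-first p) m))

edge-unshifted : ∀ p ps {e} → (∀ u → shiftE 2 u ≢ e) → (e ∈ edgesFrom 0 (p ∷ ps)) ⇔ (e ∈ localEdges p (head ps))
edge-unshifted p ps not-shifted rewrite edges-cons p ps =
  ∈-++-map-outside (localEdges p (head ps)) (edgesFrom 0 ps) not-shifted

edge-first : ∀ p ps {e} → InFirstBlock (proj₁ e) → (e ∈ edgesFrom 0 (p ∷ ps)) ⇔ (e ∈ localEdges p (head ps))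
edge-first p ps e-first = edge-unshifted p ps (λ u eq → first-not-shifted e-first (proj₁ u) (cong proj₁ eq))

edge-shifted : ∀ p ps e → (shiftE 2 e ∈ edgesFrom 0 (p ∷ ps)) ⇔ (e ∈ edgesFrom 0 ps)
edge-shifted p ps e rewrite edges-cons p ps =
  ∈-++-map-image shiftE-injective (localEdges p (head ps)) (edgesFrom 0 ps)
    (λ m → shifted-not-first (proj₁ e) (All.lookup (localEdges-first p (head ps)) m))

no-backward-edge : ∀ p ps {e} → ¬ InFirstBlock (proj₁ e) → InFirstBlock (proj₂ e) → e ∉ edgesFrom 0 (p ∷ ps)
no-backward-edge p ps {e} not-first end-first m = not-first (All.lookup (localEdges-first p (head ps)) local)
  where
  local : e ∈ localEdges p (head ps)
  local = Equivalence.to (edge-unshifted p ps (λ u eq → first-not-shifted end-first (proj₂ u) (cong proj₂ eq))) m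

vertexTest : ℕ → ℕ → Bool × Bool → Bool
vertexTest c r p = isYes ((c , r) ∈Pt? blockV p)

vertexCirc : List (OneBit n (Bool × Bool)) → ℕ → ℕ → Circ n
vertexCirc []       c             r = K false
vertexCirc (s ∷ ss) (suc (suc c)) r = vertexCirc ss c r
vertexCirc (s ∷ ss) c             r = select s (K ∘ vertexTest c r)

vertexTest-correct : ∀ s ss c r (x : Vec Bool n) → c ≤ 1 →
  T (eval (select s (K ∘ vertexTest c r)) x) ⇔ ((c , r) ∈ vertsFrom 0 (map (value x) (s ∷ ss)))
vertexTest-correct s ss c r x c≤1 = begin
  T (eval (select s (K ∘ vertexTest c r)) x)            ≡⟨ cong T (eval-selectK s (vertexTest c r) x) ⟩
  T (vertexTest c r (value x s))                        ∼⟨ decided _ ⟩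
  (c , r) ∈ blockV (value x s)                          ∼⟨ ⇔-sym (vertex-first _ (map (value x) ss) c≤1) ⟩
  (c , r) ∈ vertsFrom 0 (map (value x) (s ∷ ss))        ∎
  where open ⇔-Reasoning

vertexCirc-correct : ∀ ss c r (x : Vec Bool n) →
  T (eval (vertexCirc ss c r) x) ⇔ ((c , r) ∈ vertsFrom 0 (map (value x) ss))
vertexCirc-correct []       c             r x = mk⇔ (λ ()) (λ ())
vertexCirc-correct (s ∷ ss) 0             r x = vertexTest-correct s ss 0 r x z≤n
vertexCirc-correct (s ∷ ss) 1             r x = vertexTest-correct s ss 1 r x (s≤s z≤n)
vertexCirc-correct (s ∷ ss) (suc (suc c)) r x =
  ⇔-trans (vertexCirc-correct ss c r x) (⇔-sym (vertex-shifted (value x s) (map (value x) ss) (c , r)))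

edgeTest : Edge → Bool × Bool → Maybe (Bool × Bool) → Bool
edgeTest e p mq = isYes (e ∈Edge? localEdges p mq)

-- Is ((c₁, r₁), (c₂, r₂)) an edge?  Walk to the block containing column c₁
-- and test its pair and the next one; edges never point back to earlier blocks.
edgeCirc : List (OneBit n (Bool × Bool)) → ℕ → ℕ → ℕ → ℕ → Circ n
edgeCirc []       c₁             r₁ c₂             r₂ = K false
edgeCirc (s ∷ ss) (suc (suc c₁)) r₁ (suc (suc c₂)) r₂ = edgeCirc ss c₁ r₁ c₂ r₂
edgeCirc (s ∷ ss) (suc (suc c₁)) r₁ c₂             r₂ = K false
edgeCirc (s ∷ ss) c₁             r₁ c₂             r₂ =
  select s (λ p → select (nextOf ss) (K ∘ edgeTest ((c₁ , r₁) , (c₂ , r₂)) p))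

edgeTest-correct : ∀ s ss e (x : Vec Bool n) → InFirstBlock (proj₁ e) →
  T (eval (select s (λ p → select (nextOf ss) (K ∘ edgeTest e p))) x) ⇔ (e ∈ edgesFrom 0 (map (value x) (s ∷ ss)))
edgeTest-correct s ss e x e-first = begin
  T (eval (select s (λ p → select (nextOf ss) (K ∘ edgeTest e p))) x)
    ≡⟨ cong T (eval-selectK₂ s (nextOf ss) (edgeTest e) x) ⟩
  T (edgeTest e (value x s) (value x (nextOf ss)))
    ≡⟨ cong (T ∘ edgeTest e (value x s)) (value-nextOf x ss) ⟩
  T (edgeTest e (value x s) (head (map (value x) ss)))
    ∼⟨ decided _ ⟩
  e ∈ localEdges (value x s) (head (map (value x) ss))
    ∼⟨ ⇔-sym (edge-first (value x s) (map (value x) ss) e-first) ⟩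
  e ∈ edgesFrom 0 (map (value x) (s ∷ ss)) ∎
  where open ⇔-Reasoning

edgeCirc-correct : ∀ ss c₁ r₁ c₂ r₂ (x : Vec Bool n) →
  T (eval (edgeCirc ss c₁ r₁ c₂ r₂) x) ⇔ (((c₁ , r₁) , (c₂ , r₂)) ∈ edgesFrom 0 (map (value x) ss))
edgeCirc-correct []       c₁ r₁ c₂ r₂ x = mk⇔ (λ ()) (λ ())
edgeCirc-correct (s ∷ ss) 0  r₁ c₂ r₂ x = edgeTest-correct s ss _ x z≤n
edgeCirc-correct (s ∷ ss) 1  r₁ c₂ r₂ x = edgeTest-correct s ss _ x (s≤s z≤n)
edgeCirc-correct (s ∷ ss) (suc (suc c₁)) r₁ 0 r₂ x =
  mk⇔ (λ ()) (⊥-elim ∘ no-backward-edge (value x s) (map (value x) ss) (shifted-not-first (c₁ , r₁)) z≤n)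
edgeCirc-correct (s ∷ ss) (suc (suc c₁)) r₁ 1 r₂ x =
  mk⇔ (λ ()) (⊥-elim ∘ no-backward-edge (value x s) (map (value x) ss) (shifted-not-first (c₁ , r₁)) (s≤s z≤n))
edgeCirc-correct (s ∷ ss) (suc (suc c₁)) r₁ (suc (suc c₂)) r₂ x =
  ⇔-trans (edgeCirc-correct ss c₁ r₁ c₂ r₂ x)
          (⇔-sym (edge-shifted (value x s) (map (value x) ss) ((c₁ , r₁) , (c₂ , r₂))))

vertexCirc-small : ∀ (ss : List (OneBit n (Bool × Bool))) c r → Small 3 8 (vertexCirc ss c r)
vertexCirc-small []       c             r = small-weaken (s≤s z≤n) (s≤s z≤n) (K-small false)
vertexCirc-small (s ∷ ss) 0             r = select-small s _ (K-small ∘ vertexTest 0 r)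
vertexCirc-small (s ∷ ss) 1             r = select-small s _ (K-small ∘ vertexTest 1 r)
vertexCirc-small (s ∷ ss) (suc (suc c)) r = vertexCirc-small ss c r

edgeTest-small : ∀ (s : OneBit n (Bool × Bool)) ss e → Small 5 22 (select s (λ p → select (nextOf ss) (K ∘ edgeTest e p)))
edgeTest-small s ss e = select-small s _ (λ p → select-small (nextOf ss) _ (K-small ∘ edgeTest e p))

edgeCirc-small : ∀ (ss : List (OneBit n (Bool × Bool))) c₁ r₁ c₂ r₂ → Small 5 22 (edgeCirc ss c₁ r₁ c₂ r₂)
edgeCirc-small []       c₁             r₁ c₂             r₂ = small-weaken (s≤s z≤n) (s≤s z≤n) (K-small false)
edgeCirc-small (s ∷ ss) 0              r₁ c₂             r₂ = edgeTest-small s ss _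
edgeCirc-small (s ∷ ss) 1              r₁ c₂             r₂ = edgeTest-small s ss _
edgeCirc-small (s ∷ ss) (suc (suc c₁)) r₁ 0              r₂ = small-weaken (s≤s z≤n) (s≤s z≤n) (K-small false)
edgeCirc-small (s ∷ ss) (suc (suc c₁)) r₁ 1              r₂ = small-weaken (s≤s z≤n) (s≤s z≤n) (K-small false)
edgeCirc-small (s ∷ ss) (suc (suc c₁)) r₁ (suc (suc c₂)) r₂ = edgeCirc-small ss c₁ r₁ c₂ r₂

either : Circ n → Circ n → Circ n
either C C′ = orG (C ∷ C′ ∷ [])

eval-either : ∀ (C C′ : Circ n) x → eval (either C C′) x ≡ eval C x ∨ eval C′ x
eval-either C C′ x = cong (eval C x ∨_) (∨-identityʳ (eval C′ x))

either-small : ∀ {d S} {C C′ : Circ n} → Small d S C → Small d S C′ → Small (suc d) (suc (2 * S)) (either C C′)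
either-small (small dC sC) (small dC′ sC′) = small (s≤s (⊔-lub dC (⊔-lub dC′ z≤n))) (s≤s (+-mono-≤ sC (+-mono-≤ sC′ z≤n)))

vertexCircuit : ∀ n → GridPt n → Circ n
vertexCircuit n (gp c r) = vertexCirc (symPairs n) (toℕ c) (toℕ r)

-- The edge circuit for the ordered pair (p, q); G_x lists each edge in one direction only.
directedEdgeCircuit : ∀ n → GridPt n → GridPt n → Circ n
directedEdgeCircuit n (gp c₁ r₁) (gp c₂ r₂) = edgeCirc (symPairs n) (toℕ c₁) (toℕ r₁) (toℕ c₂) (toℕ r₂)

edgeCircuit : ∀ n → GridPt n → GridPt n → Circ n
edgeCircuit n p q = either (directedEdgeCircuit n p q) (directedEdgeCircuit n q p)

vertexCircuit-correct : ∀ n (x : Vec Bool n) p → T (eval (vertexCircuit n p) x) ⇔ (toPt p ∈ Gx-V (toList x))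
vertexCircuit-correct n x (gp c r) =
  subst (λ ps → T (eval (vertexCircuit n (gp c r)) x) ⇔ ((toℕ c , toℕ r) ∈ vertsFrom 0 ps))
        (values-symPairs n x) (vertexCirc-correct (symPairs n) (toℕ c) (toℕ r) x)

directedEdgeCircuit-correct : ∀ n (x : Vec Bool n) p q →
  T (eval (directedEdgeCircuit n p q) x) ⇔ ((toPt p , toPt q) ∈ Gx-E (toList x))
directedEdgeCircuit-correct n x (gp c₁ r₁) (gp c₂ r₂) =
  subst (λ ps → T (eval (directedEdgeCircuit n (gp c₁ r₁) (gp c₂ r₂)) x) ⇔ (((toℕ c₁ , toℕ r₁) , (toℕ c₂ , toℕ r₂)) ∈ edgesFrom 0 ps))
        (values-symPairs n x) (edgeCirc-correct (symPairs n) (toℕ c₁) (toℕ r₁) (toℕ c₂) (toℕ r₂) x)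

edgeCircuit-correct : ∀ n (x : Vec Bool n) p q →
  T (eval (edgeCircuit n p q) x) ⇔ (((toPt p , toPt q) ∈ Gx-E (toList x)) ⊎ ((toPt q , toPt p) ∈ Gx-E (toList x)))
edgeCircuit-correct n x p q = begin
  T (eval (edgeCircuit n p q) x)
    ≡⟨ cong T (eval-either (directedEdgeCircuit n p q) (directedEdgeCircuit n q p) x) ⟩
  T (eval (directedEdgeCircuit n p q) x ∨ eval (directedEdgeCircuit n q p) x)
    ∼⟨ T-∨ ⟩
  (T (eval (directedEdgeCircuit n p q) x) ⊎ T (eval (directedEdgeCircuit n q p) x))
    ∼⟨ directedEdgeCircuit-correct n x p q ⊎-⇔ directedEdgeCircuit-correct n x q p ⟩
  (((toPt p , toPt q) ∈ Gx-E (toList x)) ⊎ ((toPt q , toPt p) ∈ Gx-E (toList x))) ∎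
  where open ⇔-Reasoning

vertexCircuit-small : ∀ n p → Small 6 45 (vertexCircuit n p)
vertexCircuit-small n (gp c r) = small-weaken (m≤m+n 3 3) (m≤m+n 8 37) (vertexCirc-small (symPairs n) (toℕ c) (toℕ r))

edgeCircuit-small : ∀ n p q → Small 6 45 (edgeCircuit n p q)
edgeCircuit-small n (gp c₁ r₁) (gp c₂ r₂) =
  either-small (edgeCirc-small (symPairs n) (toℕ c₁) (toℕ r₁) (toℕ c₂) (toℕ r₂))
               (edgeCirc-small (symPairs n) (toℕ c₂) (toℕ r₂) (toℕ c₁) (toℕ r₁))

sum-map-≤ : ∀ (g : A → ℕ) S xs → (∀ a → g a ≤ S) → sum (map g xs) ≤ S * length xs
sum-map-≤ g S []       bounded = z≤n
sum-map-≤ g S (a ∷ as) bounded =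
  subst (sum (map g (a ∷ as)) ≤_) (sym (*-suc S (length as))) (+-mono-≤ (bounded a) (sum-map-≤ g S as bounded))

length-cartesianProductWith : ∀ {C : Set} (g : A → B → C) xs ys →
  length (cartesianProductWith g xs ys) ≡ length xs * length ys
length-cartesianProductWith g []       ys = refl
length-cartesianProductWith g (x ∷ xs) ys =
  trans (length-++ (map (g x) ys)) (cong₂ _+_ (length-map (g x) ys) (length-cartesianProductWith g xs ys))

gridCount : ℕ → ℕ
gridCount n = cols n * 6

length-allFin : ∀ k → length (allFin k) ≡ k
length-allFin k = length-tabulate {n = k} (λ (i : Fin k) → i)

length-gridPts : ∀ n → length (gridPts n) ≡ gridCount n
length-gridPts n =
  trans (length-cartesianProductWith (gp {n}) (allFin (cols n)) (allFin 6)) (cong₂ _*_ (length-allFin (cols n)) (length-allFin 6))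

length-gridPairs : ∀ n → length (gridPairs n) ≡ gridCount n * gridCount n
length-gridPairs n =
  trans (length-cartesianProductWith _,_ (gridPts n) (gridPts n)) (cong₂ _*_ (length-gridPts n) (length-gridPts n))

totalSize-≤ : ∀ n V E S → (∀ p → size (V p) ≤ S) → (∀ p q → size (E p q) ≤ S) →
  totalSize n V E ≤ S * (gridCount n + gridCount n * gridCount n)
totalSize-≤ n V E S V-≤ E-≤ = begin
  totalSize n V E
    ≤⟨ +-mono-≤ (sum-map-≤ (size ∘ V) S (gridPts n) V-≤) (sum-map-≤ (λ pq → size (E (proj₁ pq) (proj₂ pq))) S (gridPairs n) (λ pq → E-≤ (proj₁ pq) (proj₂ pq))) ⟩
  S * length (gridPts n) + S * length (gridPairs n)
    ≡⟨ cong₂ (λ a b → S * a + S * b) (length-gridPts n) (length-gridPairs n) ⟩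
  S * N + S * (N * N)
    ≡⟨ *-distribˡ-+ S N (N * N) ⟨
  S * (N + N * N) ∎
  where
  N = gridCount n
  open ≤-Reasoning

gridCount-expand : ∀ k → (4 * k + 4) * 6 + (4 * k + 4) * 6 * ((4 * k + 4) * 6) ≡ 24 * suc k + 576 * (suc k * suc k)
gridCount-expand = solve-∀

collect-600 : ∀ k → 24 * (suc k * suc k) + 576 * (suc k * suc k) ≡ 600 * ((k + 1) * ((k + 1) * 1))
collect-600 = solve-∀

gridCount-bound : ∀ n → gridCount n + gridCount n * gridCount n ≤ 600 * (n + 1) ^ 2
gridCount-bound n = begin
  gridCount n + gridCount n * gridCount n  ≡⟨ gridCount-expand n ⟩
  24 * m + 576 * (m * m)                   ≤⟨ +-monoˡ-≤ (576 * (m * m)) (*-monoʳ-≤ 24 (m≤m*n m m)) ⟩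
  24 * (m * m) + 576 * (m * m)             ≡⟨ collect-600 n ⟩
  600 * (n + 1) ^ 2                        ∎
  where
  m = suc n
  open ≤-Reasoning

totalSize-bound : ∀ n → totalSize n (vertexCircuit n) (edgeCircuit n) ≤ 45 * 600 * (n + 1) ^ 2
totalSize-bound n = begin
  totalSize n (vertexCircuit n) (edgeCircuit n)
    ≤⟨ totalSize-≤ n (vertexCircuit n) (edgeCircuit n) 45 (size-≤ ∘ vertexCircuit-small n) (λ p q → size-≤ (edgeCircuit-small n p q)) ⟩
  45 * (gridCount n + gridCount n * gridCount n)
    ≤⟨ *-monoʳ-≤ 45 (gridCount-bound n) ⟩
  45 * (600 * (n + 1) ^ 2)
    ≡⟨ *-assoc 45 600 ((n + 1) ^ 2) ⟨
  45 * 600 * (n + 1) ^ 2 ∎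
  where open ≤-Reasoning

lemma6 : Σ ℕ λ d → Σ ℕ λ c → Σ ℕ λ k → (n : ℕ) →
    Σ (GridPt n → Circ n) λ V →
    Σ (GridPt n → GridPt n → Circ n) λ E →
      ((p : GridPt n) → depth (V p) ≤ d) ×
      ((p q : GridPt n) → depth (E p q) ≤ d) ×
      (totalSize n V E ≤ c * (n + 1) ^ k) ×
      ((x : Vec Bool n) (p : GridPt n) →
        T (eval (V p) x) ⇔ (toPt p ∈ Gx-V (toList x))) ×
      ((x : Vec Bool n) (p q : GridPt n) →
        T (eval (E p q) x) ⇔ (((toPt p , toPt q) ∈ Gx-E (toList x)) ⊎ ((toPt q , toPt p) ∈ Gx-E (toList x))))
lemma6 = 6 , 45 * 600 , 2 , λ n →
  vertexCircuit n ,
  edgeCircuit n ,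
  (depth-≤ ∘ vertexCircuit-small n) ,
  (λ p q → depth-≤ (edgeCircuit-small n p q)) ,
  totalSize-bound n ,
  vertexCircuit-correct n ,
  edgeCircuit-correct n
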